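{- For every countable ordinal $\alpha$ there exists a well-quasi-ordered prime interval order $P_\alpha$ whose chain $AM(P_\alpha)_{\le}$ of maximal antichains has Hausdorff rank $\alpha$.
   Context: A poset is an interval order if it is isomorphic to a set of nonempty intervals of some chain, ordered by $I<J$ iff $x<y$ for all $x\in I$, $y\in J$. A module of a poset $(V,\le)$ is a subset $A\subseteq V$ such that for all $a,a'\in A$ and $x\notin A$: $x\le a\iff x\le a'$ and $a\le x\iff a'\le x$; the poset is prime if its only modules are $\varnothing$, singletons and $V$. A poset is well-quasi-ordered if it has no infinite strictly descending chain and no infinite antichain. $AM(P)$ is the set of maximal antichains of $P$ ordered by $A\le B$ iff every $a\in A$ is below some $b\in B$; for an interval order it is a chain. Hausdorff rank of scattered chains: chains of rank $0$ are the finite chains and the chains of order type $\omega$, $\omega^*$ and $\mathbb{Z}$; a scattered chain has rank $\alpha$ if $\alpha$ is the least ordinal such that it is a linear sum, indexed by a chain of rank $0$, of chains of rank $<\alpha$ (every scattered chain decomposes as such a sum of chains of strictly lesser rank). -}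

module Defs where

open import Level using (Level; 0ℓ; Lift; lift) renaming (suc to lsuc)
open import Data.Nat as ℕ using (ℕ; zero; suc)
open import Data.Fin as Fin using (Fin)
open import Data.Integer as ℤ using (ℤ)
open import Data.Product using (Σ; Σ-syntax; _×_; _,_; proj₁; proj₂)
open import Data.Sum using (_⊎_)
open import Data.Empty using (⊥)
open import Relation.Nullary using (¬_)
open import Relation.Unary using (Pred; _∈_; _∉_; _⊆_)
open import Relation.Binary using (IsPartialOrder; StrictTotalOrder)
open import Relation.Binary.PropositionalEquality using (_≡_; _≢_; subst)
open import Function.Bundles using (_⇔_)

-- Countable ordinals, as Brouwer trees (zero, successor, ω-limits)

data Ord : Set where
  ozero : Ord
  osuc  : Ord → Ord
  olim  : (ℕ → Ord) → Ord

infix 4 _≤ₒ_ _<ₒ_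
data _≤ₒ_ : Ord → Ord → Set where
  z≤ₒ   : ∀ {b} → ozero ≤ₒ b
  s≤ₒs  : ∀ {a b} → a ≤ₒ b → osuc a ≤ₒ osuc b
  ≤ₒlim : ∀ {a f} (n : ℕ) → a ≤ₒ f n → a ≤ₒ olim f
  lim≤ₒ : ∀ {f b} → (∀ n → f n ≤ₒ b) → olim f ≤ₒ b

_<ₒ_ : Ord → Ord → Set
a <ₒ b = osuc a ≤ₒ b

record Pos : Set₁ where
  field
    Carrier   : Set
    _≤_       : Carrier → Carrier → Set
    isPartial : IsPartialOrder _≡_ _≤_

  _<_ : Carrier → Carrier → Set
  x < y = (x ≤ y) × (x ≢ y)

  Subset : Set₁
  Subset = Pred Carrier 0ℓ

  IsAntichain : Subset → Set
  IsAntichain A = ∀ a b → a ∈ A → b ∈ A → a ≤ b → a ≡ b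

  IsMaxAntichain : Subset → Set₁
  IsMaxAntichain A = IsAntichain A × (∀ (B : Subset) → IsAntichain B → A ⊆ B → B ⊆ A)

  IsModule : Subset → Set
  IsModule A = ∀ a a' x → a ∈ A → a' ∈ A → x ∉ A →
               ((x ≤ a) ⇔ (x ≤ a')) × ((a ≤ x) ⇔ (a' ≤ x))

  IsPrime : Set₁
  IsPrime = ∀ (A : Subset) → IsModule A →
              (∀ x → x ∉ A)
            ⊎ (Σ[ v ∈ Carrier ] (∀ x → (x ∈ A) ⇔ (x ≡ v)))
            ⊎ (∀ x → x ∈ A)

  IsWQO : Set
  IsWQO = (¬ (Σ[ f ∈ (ℕ → Carrier) ] (∀ n → f (suc n) < f n)))
        × (¬ (Σ[ f ∈ (ℕ → Carrier) ] (∀ m n → m ≢ n → ¬ (f m ≤ f n))))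

open Pos public using (Carrier)

module _ (L : StrictTotalOrder 0ℓ 0ℓ 0ℓ) where
  open StrictTotalOrder L renaming (Carrier to ∣L∣; _<_ to _<L_; _≈_ to _≈L_)

  IsInterval : Pred ∣L∣ 0ℓ → Set
  IsInterval I = (Σ[ a ∈ ∣L∣ ] a ∈ I)
               × (∀ a b c → a ∈ I → c ∈ I → a <L b → b <L c → b ∈ I)
               × (∀ a b → a ≈L b → a ∈ I → b ∈ I)

  Precedes : Pred ∣L∣ 0ℓ → Pred ∣L∣ 0ℓ → Set
  Precedes I J = ∀ x y → x ∈ I → y ∈ J → x <L y

_≐_ : ∀ {A : Set} → Pred A 0ℓ → Pred A 0ℓ → Set
I ≐ J = (I ⊆ J) × (J ⊆ I)

IsIntervalOrder : Pos → Set₁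
IsIntervalOrder P =
  Σ[ L ∈ StrictTotalOrder 0ℓ 0ℓ 0ℓ ]
  Σ[ f ∈ (Carrier P → Pred (StrictTotalOrder.Carrier L) 0ℓ) ]
      (∀ x → IsInterval L (f x))
    × (∀ x y → f x ≐ f y → x ≡ y)
    × (∀ x y → (Pos._≤_ P x y) ⇔ ((f x ≐ f y) ⊎ Precedes L (f x) (f y)))

-- Ordered structures (carrier, equality, order); chains are recognised
-- through isomorphism with the concrete rank-0 chains and their sums.

record OrdStr : Set₂ where
  field
    Car  : Set₁
    _≈_  : Car → Car → Set
    _≤_  : Car → Car → Set

record _≅_ (C D : OrdStr) : Set₁ where
  open OrdStr C renaming (Car to A; _≈_ to _≈₁_; _≤_ to _≤₁_)
  open OrdStr D renaming (Car to B; _≈_ to _≈₂_; _≤_ to _≤₂_)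
  field
    to       : A → B
    from     : B → A
    to-cong  : ∀ {x y} → x ≈₁ y → to x ≈₂ to y
    from-cong : ∀ {x y} → x ≈₂ y → from x ≈₁ from y
    from-to  : ∀ x → from (to x) ≈₁ x
    to-from  : ∀ y → to (from y) ≈₂ y
    mono     : ∀ x y → (x ≤₁ y) ⇔ (to x ≤₂ to y)

AM : Pos → OrdStr
AM P = record
  { Car = Σ[ A ∈ Subset ] IsMaxAntichain A
  ; _≈_ = λ A B → proj₁ A ≐ proj₁ B
  ; _≤_ = λ A B → ∀ a → a ∈ proj₁ A → Σ[ b ∈ Carrier P ] (b ∈ proj₁ B × (a ≤ b))
  }
  where open Pos P

data Idx : Set where
  fin    : ℕ → Idx
  omega  : Idx
  omega* : Idx
  zed    : Idx

⟦_⟧ : Idx → Set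
⟦ fin n ⟧ = Fin n
⟦ omega ⟧ = ℕ
⟦ omega* ⟧ = ℕ
⟦ zed ⟧ = ℤ

_<[_]_ : ∀ {I : Idx} → ⟦ I ⟧ → (J : Idx) → ⟦ I ⟧ → Set
_<[_]_ {fin n}  i _ j = i Fin.< j
_<[_]_ {omega}  i _ j = i ℕ.< j
_<[_]_ {omega*} i _ j = j ℕ.< i
_<[_]_ {zed}    i _ j = i ℤ.< j

Concrete : Idx → OrdStr
Concrete I = record
  { Car = Lift (lsuc 0ℓ) ⟦ I ⟧
  ; _≈_ = λ { (lift i) (lift j) → i ≡ j }
  ; _≤_ = λ { (lift i) (lift j) → (i <[ I ] j) ⊎ (i ≡ j) }
  }

IsRank0 : OrdStr → Set₁
IsRank0 C = Σ[ I ∈ Idx ] (C ≅ Concrete I)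

LinSum : (I : Idx) → (⟦ I ⟧ → OrdStr) → OrdStr
LinSum I D = record
  { Car = Σ[ i ∈ Lift (lsuc 0ℓ) ⟦ I ⟧ ] OrdStr.Car (D (Level.lower i))
  ; _≈_ = λ { (lift i , x) (lift j , y) →
              Σ[ e ∈ i ≡ j ] OrdStr._≈_ (D j) (subst (λ k → OrdStr.Car (D k)) e x) y }
  ; _≤_ = λ { (lift i , x) (lift j , y) →
              (i <[ I ] j)
            ⊎ (Σ[ e ∈ i ≡ j ] OrdStr._≤_ (D j) (subst (λ k → OrdStr.Car (D k)) e x) y) }
  }

data RankLe : Ord → OrdStr → Set₂ where
  base : ∀ {α C} → IsRank0 C → RankLe α C
  sum  : ∀ {α C} (I : Idx) (D : ⟦ I ⟧ → OrdStr) →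
         (∀ i → Σ[ β ∈ Ord ] (β <ₒ α × RankLe β (D i))) →
         C ≅ LinSum I D → RankLe α C

HasHausdorffRank : OrdStr → Ord → Set₂
HasHausdorffRank C α = RankLe α C × (∀ β → β <ₒ α → ¬ RankLe β C)

{-# OPTIONS --safe #-}
-- For a well-founded ω-branching tree t let W(t) be the well-order obtained by putting a
-- copy of ω at every leaf and ordering lexicographically, and let P(t) consist of the
-- unit intervals [x, x+1] of W(t) together with, for every leaf v, a jump interval that
-- ends at the first point of v and begins two points into an earlier leaf (for the very
-- first leaf it is a single point).
--
-- A maximal antichain of an interval order is the set of intervals through one point
-- (the least right endpoint), so AM(P(t)) ≅ W(t).  Descending chains in P(t) give
-- descending right endpoints, and an infinite antichain would put infinitely many
-- intervals through one point, while only finitely many pass through any point.  A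
-- module with two elements contains two consecutive units, hence all units of their leaf;
-- since each jump overlaps units of an earlier leaf, it then contains all units of the
-- first leaf, and from there every element.
--
-- W(t) is the ω-sum of the W(t k), which gives rank ≤ α for a suitable tree.  For the
-- lower bound, nesting ω-sums along γ gives a chain that embeds into no chain of rank
-- β < γ: a bounded monotone ω-sequence in a rank-0 chain is eventually constant, so in a
-- sum of chains of rank < β a tail of the blocks of such a copy lands in one summand.
module Submission where

open import Defs
open import Level using (Level; 0ℓ; Lift; lift; lower; Setω) renaming (suc to lsuc)
open import Axiom.ExcludedMiddle using (ExcludedMiddle)
open import Data.Empty using (⊥; ⊥-elim)
open import Data.Unit using (⊤; tt)
open import Data.Product using (Σ; Σ-syntax; ∃-syntax; _×_; _,_; proj₁; proj₂)
open import Data.Sum using (_⊎_; inj₁; inj₂)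
open import Data.Maybe using (Maybe; just; nothing; maybe)
open import Data.Nat as ℕ using (ℕ; zero; suc; _+_; _∸_; z≤n; s≤s)
import Data.Nat.Properties as ℕₚ
open import Data.Nat.Induction using (<-wellFounded)
open import Data.Fin using (Fin; toℕ)
import Data.Fin.Properties as Finₚ
open import Data.Integer as ℤ using (ℤ)
import Data.Integer.Properties as ℤₚ
open import Data.Integer.Solver using (module +-*-Solver)
open import Data.List using (List; []; _∷_; map; _++_; length)
open import Data.List.Relation.Unary.Any using (here; there; index)
open import Data.List.Membership.Propositional using () renaming (_∈_ to _∈ˡ_)
open import Data.List.Membership.Propositional.Properties using (∈-map⁺; ∈-++⁺ˡ; ∈-++⁺ʳ)
import Data.List.Membership.Setoid.Properties as Membershipₚ
open import Function using (_∘_)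
open import Function.Bundles using (_⇔_; mk⇔; Equivalence)
open import Induction.WellFounded using (Acc; acc; WellFounded)
open import Relation.Binary using (StrictTotalOrder)
open import Relation.Binary.Definitions using (Tri; tri<; tri≈; tri>)
open import Relation.Binary.PropositionalEquality
  using (_≡_; _≢_; refl; sym; trans; cong; subst; subst₂; isEquivalence; setoid; module ≡-Reasoning)
open import Relation.Nullary using (¬_; yes; no)
open import Relation.Unary using (Pred; _∈_; _⊆_)

LEM : Setω
LEM = ∀ {ℓ : Level} → ExcludedMiddle ℓ

≤ₒ-refl : ∀ a → a ≤ₒ a
≤ₒ-refl ozero    = z≤ₒ
≤ₒ-refl (osuc a) = s≤ₒs (≤ₒ-refl a)
≤ₒ-refl (olim f) = lim≤ₒ (λ n → ≤ₒlim n (≤ₒ-refl (f n)))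

≤ₒ-trans : ∀ {a b c} → a ≤ₒ b → b ≤ₒ c → a ≤ₒ c
≤ₒ-trans z≤ₒ          _            = z≤ₒ
≤ₒ-trans (lim≤ₒ h)    q            = lim≤ₒ (λ n → ≤ₒ-trans (h n) q)
≤ₒ-trans (s≤ₒs p)     (s≤ₒs q)     = s≤ₒs (≤ₒ-trans p q)
≤ₒ-trans p@(s≤ₒs _)   (≤ₒlim n q)  = ≤ₒlim n (≤ₒ-trans p q)
≤ₒ-trans (≤ₒlim n p)  (lim≤ₒ h)    = ≤ₒ-trans p (h n)
≤ₒ-trans p@(≤ₒlim _ _) (≤ₒlim m q) = ≤ₒlim m (≤ₒ-trans p q)

≤ₒ-olim : ∀ f n → f n ≤ₒ olim f
≤ₒ-olim f n = ≤ₒlim n (≤ₒ-refl (f n))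

≤ₒ-osuc : ∀ a → a ≤ₒ osuc a
≤ₒ-osuc ozero    = z≤ₒ
≤ₒ-osuc (osuc a) = s≤ₒs (≤ₒ-osuc a)
≤ₒ-osuc (olim f) = lim≤ₒ (λ n → ≤ₒ-trans (≤ₒ-osuc (f n)) (s≤ₒs (≤ₒ-olim f n)))

<ₒ⇒≤ₒ : ∀ {a b} → a <ₒ b → a ≤ₒ b
<ₒ⇒≤ₒ {a} = ≤ₒ-trans (≤ₒ-osuc a)

osuc-≤ₒ-inv : ∀ {a b} → osuc a ≤ₒ osuc b → a ≤ₒ b
osuc-≤ₒ-inv (s≤ₒs p) = p

<ₒ-olim-inv : ∀ {a f} → a <ₒ olim f → ∃[ n ] a <ₒ f n
<ₒ-olim-inv (≤ₒlim n p) = n , p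

≤ₒ-or->ₒ : LEM → ∀ a b → a ≤ₒ b ⊎ b <ₒ a
≤ₒ-or->ₒ lem ozero    b        = inj₁ z≤ₒ
≤ₒ-or->ₒ lem (osuc a) ozero    = inj₂ (s≤ₒs z≤ₒ)
≤ₒ-or->ₒ lem (osuc a) (osuc b) with ≤ₒ-or->ₒ lem a b
... | inj₁ a≤b = inj₁ (s≤ₒs a≤b)
... | inj₂ b<a = inj₂ (s≤ₒs b<a)
≤ₒ-or->ₒ lem (osuc a) (olim g) with lem {P = ∃[ m ] osuc a ≤ₒ g m}
... | yes (m , p) = inj₁ (≤ₒlim m p)
... | no ¬p       = inj₂ (s≤ₒs (lim≤ₒ λ m → below m (≤ₒ-or->ₒ lem (osuc a) (g m))))
  where
  below : ∀ m → osuc a ≤ₒ g m ⊎ g m <ₒ osuc a → g m ≤ₒ a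
  below m (inj₁ p) = ⊥-elim (¬p (m , p))
  below m (inj₂ p) = osuc-≤ₒ-inv p
≤ₒ-or->ₒ lem (olim f) b with lem {P = ∃[ n ] ¬ (f n ≤ₒ b)}
... | yes (n , ¬p) = inj₂ (above (≤ₒ-or->ₒ lem (f n) b))
  where
  above : f n ≤ₒ b ⊎ b <ₒ f n → b <ₒ olim f
  above (inj₁ p) = ⊥-elim (¬p p)
  above (inj₂ p) = ≤ₒ-trans p (≤ₒ-olim f n)
... | no ¬p = inj₁ (lim≤ₒ below)
  where
  below : ∀ n → f n ≤ₒ b
  below n with lem {P = f n ≤ₒ b}
  ... | yes p = p
  ... | no q  = ⊥-elim (¬p (n , q))

data Tree : Set where
  leaf : Tree
  node : (ℕ → Tree) → Tree

Pt : Tree → Set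
Pt leaf     = ℕ
Pt (node g) = Σ ℕ (λ k → Pt (g k))

data Lt : (t : Tree) → Pt t → Pt t → Set where
  leaf< : ∀ {m n} → m ℕ.< n → Lt leaf m n
  fst<  : ∀ {g k k′} {x : Pt (g k)} {y : Pt (g k′)} → k ℕ.< k′ → Lt (node g) (k , x) (k′ , y)
  snd<  : ∀ {g k} {x y : Pt (g k)} → Lt (g k) x y → Lt (node g) (k , x) (k , y)

infix 4 Lt Le
syntax Lt t x y = x ≺[ t ] y

Le : (t : Tree) → Pt t → Pt t → Set
Le t x y = x ≺[ t ] y ⊎ x ≡ y

syntax Le t x y = x ≼[ t ] y

≺-trans : ∀ {t} {x y z : Pt t} → x ≺[ t ] y → y ≺[ t ] z → x ≺[ t ] z
≺-trans (leaf< p) (leaf< q) = leaf< (ℕₚ.<-trans p q)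
≺-trans (fst< p)  (fst< q)  = fst< (ℕₚ.<-trans p q)
≺-trans (fst< p)  (snd< _)  = fst< p
≺-trans (snd< _)  (fst< q)  = fst< q
≺-trans (snd< p)  (snd< q)  = snd< (≺-trans p q)

≺-irrefl : ∀ {t} {x : Pt t} → ¬ x ≺[ t ] x
≺-irrefl (leaf< p) = ℕₚ.<-irrefl refl p
≺-irrefl (fst< p)  = ℕₚ.<-irrefl refl p
≺-irrefl (snd< p)  = ≺-irrefl p

≺-asym : ∀ {t} {x y : Pt t} → x ≺[ t ] y → ¬ y ≺[ t ] x
≺-asym p q = ≺-irrefl (≺-trans p q)

≺⇒≢ : ∀ {t} {x y : Pt t} → x ≺[ t ] y → x ≢ y
≺⇒≢ p refl = ≺-irrefl p

≺⇒⋡ : ∀ {t} {x y : Pt t} → x ≺[ t ] y → ¬ y ≼[ t ] x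
≺⇒⋡ p (inj₁ q)    = ≺-asym p q
≺⇒⋡ p (inj₂ refl) = ≺-irrefl p

≼-trans : ∀ {t} {x y z : Pt t} → x ≼[ t ] y → y ≼[ t ] z → x ≼[ t ] z
≼-trans (inj₁ p)    (inj₁ q)    = inj₁ (≺-trans p q)
≼-trans (inj₁ p)    (inj₂ refl) = inj₁ p
≼-trans (inj₂ refl) q           = q

≼-≺-trans : ∀ {t} {x y z : Pt t} → x ≼[ t ] y → y ≺[ t ] z → x ≺[ t ] z
≼-≺-trans (inj₁ p)    q = ≺-trans p q
≼-≺-trans (inj₂ refl) q = q

≺-≼-trans : ∀ {t} {x y z : Pt t} → x ≺[ t ] y → y ≼[ t ] z → x ≺[ t ] z
≺-≼-trans p (inj₁ q)    = ≺-trans p q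
≺-≼-trans p (inj₂ refl) = p

≼-antisym : ∀ {t} {x y : Pt t} → x ≼[ t ] y → y ≼[ t ] x → x ≡ y
≼-antisym (inj₂ e) _        = e
≼-antisym (inj₁ p) q        = ⊥-elim (≺⇒⋡ p q)

≺-compare : ∀ t (x y : Pt t) → Tri (x ≺[ t ] y) (x ≡ y) (y ≺[ t ] x)
≺-compare leaf m n with ℕₚ.<-cmp m n
... | tri< a _ _ = tri< (leaf< a) (≺⇒≢ (leaf< a)) (≺-asym (leaf< a))
... | tri≈ _ refl _ = tri≈ ≺-irrefl refl ≺-irrefl
... | tri> _ _ c = tri> (≺-asym (leaf< c)) (λ e → ≺⇒≢ (leaf< c) (sym e)) (leaf< c)
≺-compare (node g) (k , x) (k′ , y) with ℕₚ.<-cmp k k′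
... | tri< a _ _ = tri< (fst< a) (≺⇒≢ (fst< a)) (≺-asym (fst< a))
... | tri> _ _ c = tri> (≺-asym (fst< c)) (λ e → ≺⇒≢ (fst< c) (sym e)) (fst< c)
... | tri≈ _ refl _ with ≺-compare (g k) x y
...   | tri< a _ _ = tri< (snd< a) (≺⇒≢ (snd< a)) (≺-asym (snd< a))
...   | tri≈ _ refl _ = tri≈ ≺-irrefl refl ≺-irrefl
...   | tri> _ _ c = tri> (≺-asym (snd< c)) (λ e → ≺⇒≢ (snd< c) (sym e)) (snd< c)

≼-or-≻ : ∀ t (x y : Pt t) → x ≼[ t ] y ⊎ y ≺[ t ] x
≼-or-≻ t x y with ≺-compare t x y
... | tri< a _ _ = inj₁ (inj₁ a)
... | tri≈ _ e _ = inj₁ (inj₂ e)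
... | tri> _ _ c = inj₂ c

chain : Tree → StrictTotalOrder 0ℓ 0ℓ 0ℓ
chain t = record
  { Carrier = Pt t
  ; _≈_ = _≡_
  ; _<_ = Lt t
  ; isStrictTotalOrder = record
    { isStrictPartialOrder = record
      { isEquivalence = isEquivalence
      ; irrefl = λ { refl → ≺-irrefl }
      ; trans = ≺-trans
      ; <-resp-≈ = (λ { refl p → p }) , (λ { refl p → p }) }
    ; compare = ≺-compare t } }

≺-wellFounded : ∀ t → WellFounded (Lt t)
≺-wellFounded leaf n = accLeaf (<-wellFounded n)
  where
  accLeaf : ∀ {n} → Acc ℕ._<_ n → Acc (Lt leaf) n
  accLeaf (acc r) = acc λ { (leaf< p) → accLeaf (r p) }
≺-wellFounded (node g) (k , x) = acc (accNode (<-wellFounded k) (≺-wellFounded (g k) x))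
  where
  accNode : ∀ {k x} → Acc ℕ._<_ k → Acc (Lt (g k)) x →
            ∀ {y} → y ≺[ node g ] (k , x) → Acc (Lt (node g)) y
  accNode (acc rk) _  (fst< p) = acc (accNode (rk p) (≺-wellFounded (g _) _))
  accNode ak (acc rx) (snd< q) = acc (accNode ak (rx q))

-- The leaves of t; the leaf v carries the copy { start v +ₚ n } of ω in Pt t.
Block : Tree → Set
Block leaf     = ⊤
Block (node g) = Σ ℕ (λ k → Block (g k))

start : ∀ {t} → Block t → Pt t
start {leaf}   _       = 0
start {node g} (k , v) = k , start v

firstBlock : ∀ {t} → Block t
firstBlock {leaf}   = tt
firstBlock {node g} = 0 , firstBlock

least : ∀ {t} → Pt t
least = start firstBlock

succ : ∀ {t} → Pt t → Pt t
succ {leaf}   n       = suc n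
succ {node g} (k , x) = k , succ x

infixl 6 _+ₚ_
_+ₚ_ : ∀ {t} → Pt t → ℕ → Pt t
x +ₚ zero  = x
x +ₚ suc n = succ (x +ₚ n)

blockOf : ∀ {t} → Pt t → Block t
blockOf {leaf}   _       = tt
blockOf {node g} (k , x) = k , blockOf x

offset : ∀ {t} → Pt t → ℕ
offset {leaf}   n       = n
offset {node g} (k , x) = offset x

predₚ : ∀ {t} → Pt t → Pt t
predₚ {leaf}   n       = ℕ.pred n
predₚ {node g} (k , x) = k , predₚ x

,-+ₚ : ∀ {g} k (x : Pt (g k)) n → _+ₚ_ {node g} (k , x) n ≡ (k , x +ₚ n)
,-+ₚ k x zero    = refl
,-+ₚ k x (suc n) = cong succ (,-+ₚ k x n)

start-+ₚ-offset : ∀ {t} (x : Pt t) → start (blockOf x) +ₚ offset x ≡ x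
start-+ₚ-offset {leaf}   zero    = refl
start-+ₚ-offset {leaf}   (suc n) = cong suc (start-+ₚ-offset {leaf} n)
start-+ₚ-offset {node g} (k , x) =
  trans (,-+ₚ k (start (blockOf x)) (offset x)) (cong (k ,_) (start-+ₚ-offset x))

start-or-succ : ∀ {t} (x : Pt t) → (∃[ v ] x ≡ start v) ⊎ (∃[ y ] x ≡ succ y)
start-or-succ {leaf}   zero    = inj₁ (tt , refl)
start-or-succ {leaf}   (suc n) = inj₂ (n , refl)
start-or-succ {node g} (k , x) with start-or-succ x
... | inj₁ (v , refl) = inj₁ ((k , v) , refl)
... | inj₂ (y , refl) = inj₂ ((k , y) , refl)

,-injective : ∀ {g : ℕ → Tree} {k} {x y : Pt (g k)} → _≡_ {A = Pt (node g)} (k , x) (k , y) → x ≡ y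
,-injective refl = refl

predₚ-succ : ∀ {t} (x : Pt t) → predₚ (succ x) ≡ x
predₚ-succ {leaf}   n       = refl
predₚ-succ {node g} (k , x) = cong (k ,_) (predₚ-succ x)

succ-injective : ∀ {t} {x y : Pt t} → succ x ≡ succ y → x ≡ y
succ-injective {x = x} {y} e = trans (sym (predₚ-succ x)) (trans (cong predₚ e) (predₚ-succ y))

blockOf-start : ∀ {t} (v : Block t) → blockOf (start v) ≡ v
blockOf-start {leaf}   tt      = refl
blockOf-start {node g} (k , v) = cong (k ,_) (blockOf-start v)

start-injective : ∀ {t} {v w : Block t} → start v ≡ start w → v ≡ w
start-injective {v = v} {w} e = trans (sym (blockOf-start v)) (trans (cong blockOf e) (blockOf-start w))

offset-succ : ∀ {t} (x : Pt t) → offset (succ x) ≡ suc (offset x)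
offset-succ {leaf}   n       = refl
offset-succ {node g} (k , x) = offset-succ x

offset-start : ∀ {t} (v : Block t) → offset (start v) ≡ 0
offset-start {leaf}   _       = refl
offset-start {node g} (k , v) = offset-start v

succ≢start : ∀ {t} (x : Pt t) (v : Block t) → succ x ≢ start v
succ≢start x v e with trans (sym (offset-succ x)) (trans (cong offset e) (offset-start v))
... | ()

≺-succ : ∀ {t} (x : Pt t) → x ≺[ t ] succ x
≺-succ {leaf}   n       = leaf< (ℕₚ.n<1+n n)
≺-succ {node g} (k , x) = snd< (≺-succ x)

succ-mono : ∀ {t} {x y : Pt t} → x ≺[ t ] y → succ x ≺[ t ] succ y
succ-mono (leaf< p) = leaf< (s≤s p)
succ-mono (fst< p)  = fst< p
succ-mono (snd< p)  = snd< (succ-mono p)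

succ-≼ : ∀ {t} {x z : Pt t} → x ≺[ t ] z → succ x ≼[ t ] z
succ-≼ (leaf< p) with ℕₚ.m≤n⇒m<n∨m≡n p
... | inj₁ q = inj₁ (leaf< q)
... | inj₂ q = inj₂ q
succ-≼ (fst< p) = inj₁ (fst< p)
succ-≼ (snd< p) with succ-≼ p
... | inj₁ q    = inj₁ (snd< q)
... | inj₂ refl = inj₂ refl

least-≼ : ∀ {t} (x : Pt t) → least ≼[ t ] x
least-≼ {leaf}   zero          = inj₂ refl
least-≼ {leaf}   (suc n)       = inj₁ (leaf< (s≤s z≤n))
least-≼ {node g} (suc k , x)   = inj₁ (fst< (s≤s z≤n))
least-≼ {node g} (zero , x) with least-≼ x
... | inj₁ p    = inj₁ (snd< p)
... | inj₂ refl = inj₂ refl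

-- Not the immediate predecessor of v, which need not exist: at the deepest node on the
-- path to v where v lies in a branch k > 0, the first leaf of branch k ∸ 1.
prevBlock : ∀ {t} → Block t → Maybe (Block t)
prevBlock {leaf}   _       = nothing
prevBlock {node g} (k , v) = prevInNode k (prevBlock v)
  where
  prevInNode : ∀ k → Maybe (Block (g k)) → Maybe (Block (node g))
  prevInNode k       (just w) = just (k , w)
  prevInNode zero    nothing  = nothing
  prevInNode (suc k) nothing  = just (k , firstBlock)

jumpStart : ∀ {t} → Block t → Pt t
jumpStart v = maybe (λ w → succ (succ (start w))) (start v) (prevBlock v)

prevBlock-firstBlock : ∀ {t} → prevBlock {t} firstBlock ≡ nothing
prevBlock-firstBlock {leaf}   = refl
prevBlock-firstBlock {node g} rewrite prevBlock-firstBlock {g 0} = refl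

prevBlock≡nothing : ∀ {t} (v : Block t) → prevBlock v ≡ nothing → v ≡ firstBlock
prevBlock≡nothing {leaf}   tt      _ = refl
prevBlock≡nothing {node g} (k , v) e with prevBlock v in eq
prevBlock≡nothing {node g} (zero , v)  e  | nothing = cong (0 ,_) (prevBlock≡nothing v eq)
prevBlock≡nothing {node g} (suc k , v) () | nothing
prevBlock≡nothing {node g} (k , v)     () | just w

prevBlock-≺ : ∀ {t} (v w : Block t) → prevBlock v ≡ just w → ∀ n → start w +ₚ n ≺[ t ] start v
prevBlock-≺ {leaf}   tt      w () n
prevBlock-≺ {node g} (k , v) w e  n with prevBlock v in eq
prevBlock-≺ {node g} (k , v)     .(k , w) refl n | just w =
  subst (λ z → z ≺[ node g ] (k , start v)) (sym (,-+ₚ k (start w) n)) (snd< (prevBlock-≺ v w eq n))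
prevBlock-≺ {node g} (zero , v)  w ()   n | nothing
prevBlock-≺ {node g} (suc k , v) .(k , firstBlock) refl n | nothing =
  subst (λ z → z ≺[ node g ] (suc k , start v)) (sym (,-+ₚ k least n)) (fst< (ℕₚ.n<1+n k))

jumpStart-≼-start : ∀ {t} (v : Block t) → jumpStart v ≼[ t ] start v
jumpStart-≼-start v with prevBlock v in eq
... | just w  = inj₁ (prevBlock-≺ v w eq 2)
... | nothing = inj₂ refl

jumpStart-firstBlock : ∀ {t} → jumpStart {t} firstBlock ≡ least
jumpStart-firstBlock {t} rewrite prevBlock-firstBlock {t} = refl

data JumpView {t} (v : Block t) : Set where
  first : v ≡ firstBlock → JumpView v
  after : ∀ w → prevBlock v ≡ just w → jumpStart v ≡ succ (succ (start w)) → JumpView v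

jumpView : ∀ {t} (v : Block t) → JumpView v
jumpView v with prevBlock v in eq
... | just w  = after w eq (cong (maybe (λ w → succ (succ (start w))) (start v)) eq)
... | nothing = first (prevBlock≡nothing v eq)

succ-least-≺-jumpStart : ∀ {t} (v : Block t) → v ≢ firstBlock → succ least ≺[ t ] jumpStart v
succ-least-≺-jumpStart v v≢first with jumpView v
... | first e      = ⊥-elim (v≢first e)
... | after w _ js rewrite js = ≼-≺-trans (succ-≼-succ (least-≼ (start w))) (≺-succ _)
  where
  succ-≼-succ : ∀ {t} {x y : Pt t} → x ≼[ t ] y → succ x ≼[ t ] succ y
  succ-≼-succ (inj₁ p)    = inj₁ (succ-mono p)
  succ-≼-succ (inj₂ refl) = inj₂ refl

Elem : Tree → Set
Elem t = Pt t ⊎ Block t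

pattern unit x = inj₁ x
pattern jump v = inj₂ v

left : ∀ {t} → Elem t → Pt t
left (unit x) = x
left (jump v) = jumpStart v

right : ∀ {t} → Elem t → Pt t
right (unit x) = succ x
right (jump v) = start v

left-≼-right : ∀ {t} (c : Elem t) → left c ≼[ t ] right c
left-≼-right (unit x) = inj₁ (≺-succ x)
left-≼-right (jump v) = jumpStart-≼-start v

right-injective : ∀ {t} {c d : Elem t} → right c ≡ right d → c ≡ d
right-injective {c = unit x} {unit y} e = cong unit (succ-injective e)
right-injective {c = unit x} {jump w} e = ⊥-elim (succ≢start x w e)
right-injective {c = jump v} {unit y} e = ⊥-elim (succ≢start y v (sym e))
right-injective {c = jump v} {jump w} e = cong jump (start-injective e)

infix 4 _⊑_
_⊑_ : ∀ {t} → Elem t → Elem t → Set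
_⊑_ {t} c d = c ≡ d ⊎ right c ≺[ t ] left d

right-⊀-left : ∀ {t} (c : Elem t) → ¬ right c ≺[ t ] left c
right-⊀-left c p = ≺⇒⋡ p (left-≼-right c)

⊑-trans : ∀ {t} {a b c : Elem t} → a ⊑ b → b ⊑ c → a ⊑ c
⊑-trans (inj₁ refl) q = q
⊑-trans (inj₂ p) (inj₁ refl) = inj₂ p
⊑-trans {b = b} (inj₂ p) (inj₂ q) = inj₂ (≺-trans p (≼-≺-trans (left-≼-right b) q))

⊑-antisym : ∀ {t} {a b : Elem t} → a ⊑ b → b ⊑ a → a ≡ b
⊑-antisym (inj₁ e) _ = e
⊑-antisym (inj₂ p) (inj₁ e) = sym e
⊑-antisym {a = a} {b} (inj₂ p) (inj₂ q) =
  ⊥-elim (right-⊀-left a (≺-trans p (≼-≺-trans (left-≼-right b) q)))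

intervalPoset : Tree → Pos
intervalPoset t = record
  { Carrier = Elem t
  ; _≤_ = _⊑_
  ; isPartial = record
    { isPreorder = record
      { isEquivalence = isEquivalence
      ; reflexive = inj₁
      ; trans = ⊑-trans }
    ; antisym = ⊑-antisym } }

interval : ∀ {t} → Elem t → Pred (Pt t) 0ℓ
interval {t} c z = left c ≼[ t ] z × z ≼[ t ] right c

isIntervalOrder : ∀ t → IsIntervalOrder (intervalPoset t)
isIntervalOrder t = chain t , interval , isInterval , injective , ⊑⇔
  where
  isInterval : ∀ c → IsInterval (chain t) (interval c)
  isInterval c = (left c , inj₂ refl , left-≼-right c)
               , (λ _ _ _ (l≼a , _) (_ , c≼r) a<b b<c →
                    ≼-trans l≼a (inj₁ a<b) , ≼-trans (inj₁ b<c) c≼r)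
               , λ { _ _ refl z∈ → z∈ }
  right∈ : ∀ c → right c ∈ interval c
  right∈ c = left-≼-right c , inj₂ refl
  left∈ : ∀ c → left c ∈ interval c
  left∈ c = inj₂ refl , left-≼-right c
  injective : ∀ c d → interval c ≐ interval d → c ≡ d
  injective c d (c⊆d , d⊆c) =
    right-injective (≼-antisym (proj₂ (c⊆d (right∈ c))) (proj₂ (d⊆c (right∈ d))))
  ⊑⇔ : ∀ c d → c ⊑ d ⇔ (interval c ≐ interval d ⊎ Precedes (chain t) (interval c) (interval d))
  ⊑⇔ c d = mk⇔ to from
    where
    to : c ⊑ d → interval c ≐ interval d ⊎ Precedes (chain t) (interval c) (interval d)
    to (inj₁ refl) = inj₁ ((λ z∈ → z∈) , (λ z∈ → z∈))
    to (inj₂ p)    = inj₂ λ _ _ (_ , x≼r) (l≼y , _) → ≼-≺-trans x≼r (≺-≼-trans p l≼y)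
    from : interval c ≐ interval d ⊎ Precedes (chain t) (interval c) (interval d) → c ⊑ d
    from (inj₁ e)       = inj₁ (injective c d e)
    from (inj₂ c-before-d) = inj₂ (c-before-d (right c) (left d) (right∈ c) (left∈ d))

minimal : LEM → ∀ {A : Set} {_<_ : A → A → Set} → WellFounded _<_ →
          (Q : A → Set) → ∀ {a} → Q a → ∃[ m ] (Q m × ∀ {b} → Q b → ¬ b < m)
minimal lem {_<_ = _<_} wf Q {a} qa = go (wf a) qa
  where
  go : ∀ {a} → Acc _<_ a → Q a → ∃[ m ] (Q m × ∀ {b} → Q b → ¬ b < m)
  go {a} (acc below) qa with lem {P = ∃[ b ] (Q b × b < a)}
  ... | yes (b , qb , b<a) = go (below b<a) qb
  ... | no ¬smaller        = a , qa , λ qb b<a → ¬smaller (_ , qb , b<a)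

≐-sym : ∀ {A : Set} {X Y : Pred A 0ℓ} → X ≐ Y → Y ≐ X
≐-sym (X⊆Y , Y⊆X) = Y⊆X , X⊆Y

≐-trans : ∀ {A : Set} {X Y Z : Pred A 0ℓ} → X ≐ Y → Y ≐ Z → X ≐ Z
≐-trans (X⊆Y , Y⊆X) (Y⊆Z , Z⊆Y) = (λ x∈ → Y⊆Z (X⊆Y x∈)) , (λ z∈ → Y⊆X (Z⊆Y z∈))

module _ {t : Tree} where
  open Pos (intervalPoset t) using (IsAntichain; IsMaxAntichain)

  through : Pt t → Pred (Elem t) 0ℓ
  through q c = q ∈ interval c

  Below : Pred (Elem t) 0ℓ → Pred (Elem t) 0ℓ → Set
  Below A B = ∀ a → a ∈ A → Σ[ b ∈ Elem t ] (b ∈ B × a ⊑ b)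

  Below-resp-⊆ : ∀ {A A′ B B′ : Pred (Elem t) 0ℓ} →
                 A′ ⊆ A → B ⊆ B′ → Below A B → Below A′ B′
  Below-resp-⊆ A′⊆A B⊆B′ A≤B a a∈A′ with A≤B a (A′⊆A a∈A′)
  ... | b , b∈B , a⊑b = b , B⊆B′ b∈B , a⊑b

  unit∈through : ∀ q → unit q ∈ through q
  unit∈through q = inj₂ refl , inj₁ (≺-succ q)

  elemEndingAt : ∀ q → ∃[ c ] (c ∈ through q × right c ≡ q)
  elemEndingAt q with start-or-succ q
  ... | inj₁ (v , refl) = jump v , (jumpStart-≼-start v , inj₂ refl) , refl
  ... | inj₂ (y , refl) = unit y , (inj₁ (≺-succ y) , inj₂ refl) , refl

  through-antichain : ∀ q → IsAntichain (through q)
  through-antichain q a b _         _         (inj₁ a≡b) = a≡b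
  through-antichain q a b (_ , q≼r) (l≼q , _) (inj₂ p) = ⊥-elim (≺⇒⋡ p (≼-trans l≼q q≼r))

  through-maximal : ∀ q → IsMaxAntichain (through q)
  through-maximal q = through-antichain q , maximal
    where
    maximal : ∀ B → IsAntichain B → through q ⊆ B → B ⊆ through q
    maximal B anti q⊆B {b} b∈B with ≼-or-≻ t (left b) q | ≼-or-≻ t q (right b) | elemEndingAt q
    ... | inj₁ l≼q | inj₁ q≼r | _              = l≼q , q≼r
    ... | inj₂ q<l | _        | c , c∋q , refl =
      subst (through q) (anti c b (q⊆B c∋q) b∈B (inj₂ q<l)) c∋q
    ... | inj₁ _   | inj₂ r<q | _              =
      subst (through q) (sym (anti b (unit q) b∈B (q⊆B (unit∈through q)) (inj₂ r<q))) (unit∈through q)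

  -- Helly property for intervals: q is the least right endpoint in A.
  antichain⊆through : LEM → (A : Pred (Elem t) 0ℓ) → IsAntichain A →
                      ∀ {c} → c ∈ A → ∃[ q ] (A ⊆ through q)
  antichain⊆through lem A anti c∈A
    with minimal lem (≺-wellFounded t) (λ r → ∃[ c ] (c ∈ A × right c ≡ r)) (_ , c∈A , refl)
  ... | q , (c , c∈A , refl) , least-right = q , A⊆through
    where
    A⊆through : A ⊆ through q
    A⊆through {b} b∈A with ≼-or-≻ t (left b) (right c) | ≼-or-≻ t (right c) (right b)
    ... | _         | inj₂ r<q = ⊥-elim (least-right (b , b∈A , refl) r<q)
    ... | inj₁ l≼q  | inj₁ q≼r = l≼q , q≼r
    ... | inj₂ q<l  | _ with anti c b c∈A b∈A (inj₂ q<l)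
    ...   | refl = ⊥-elim (right-⊀-left c q<l)

  maxAntichain⇒through : LEM → (A : Pred (Elem t) 0ℓ) → IsMaxAntichain A → ∃[ q ] (A ≐ through q)
  maxAntichain⇒through lem A (anti , maximal) with lem {P = ∃[ c ] c ∈ A}
  ... | yes (_ , c∈A) with antichain⊆through lem A anti c∈A
  ...   | q , A⊆through = q , A⊆through , maximal (through q) (through-antichain q) A⊆through
  maxAntichain⇒through lem A (anti , maximal) | no ¬inhabited =
    ⊥-elim (¬inhabited (unit least , maximal (_≡ unit least) singleton (λ c∈A → ⊥-elim (¬inhabited (_ , c∈A))) refl))
    where
    singleton : IsAntichain (_≡ unit least)
    singleton _ _ refl refl _ = refl

  through-Below⇔≼ : ∀ {q q′} → Below (through q) (through q′) ⇔ q ≼[ t ] q′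
  through-Below⇔≼ {q} {q′} = mk⇔ to from
    where
    to : Below (through q) (through q′) → q ≼[ t ] q′
    to below with ≼-or-≻ t q q′
    ... | inj₁ q≼q′ = q≼q′
    ... | inj₂ q′<q with below (unit q) (unit∈through q)
    ...   | _ , (l≼q′ , _) , inj₁ refl = ⊥-elim (≺⇒⋡ q′<q l≼q′)
    ...   | _ , (l≼q′ , _) , inj₂ p    = ⊥-elim (≺-asym q′<q (≺-trans (≺-succ q) (≺-≼-trans p l≼q′)))
    from : q ≼[ t ] q′ → Below (through q) (through q′)
    from q≼q′ a (l≼q , q≼r) with ≼-or-≻ t q′ (right a)
    ... | inj₁ q′≼r = a , (≼-trans l≼q q≼q′ , q′≼r) , inj₁ refl
    ... | inj₂ r<q′ = unit q′ , unit∈through q′ , inj₂ r<q′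

  through-injective : ∀ {q q′} → through q ≐ through q′ → q ≡ q′
  through-injective {q} {q′} (q⊆q′ , q′⊆q) =
    ≼-antisym (proj₁ (q⊆q′ {unit q} (unit∈through q)))
              (proj₁ (q′⊆q {unit q′} (unit∈through q′)))

chainStr : Tree → OrdStr
chainStr t = record
  { Car = Lift (lsuc 0ℓ) (Pt t)
  ; _≈_ = λ x y → lower x ≡ lower y
  ; _≤_ = λ x y → lower x ≼[ t ] lower y
  }

AM≅chain : LEM → ∀ t → AM (intervalPoset t) ≅ chainStr t
AM≅chain lem t = record
  { to = λ A → lift (pointOf A)
  ; from = λ q → through (lower q) , through-maximal (lower q)
  ; to-cong = λ {A} {B} A≐B →
      through-injective (≐-trans (≐-sym (≐through A)) (≐-trans A≐B (≐through B)))
  ; from-cong = λ { refl → (λ c∈ → c∈) , (λ c∈ → c∈) }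
  ; from-to = λ A → ≐-sym (≐through A)
  ; to-from = λ q → through-injective (≐-sym (≐through (through (lower q) , through-maximal (lower q))))
  ; mono = λ A B → mk⇔
      (λ A≤B → Equivalence.to through-Below⇔≼ (Below-resp-⊆ (proj₂ (≐through A)) (proj₁ (≐through B)) A≤B))
      (λ q≼q′ → Below-resp-⊆ (proj₁ (≐through A)) (proj₂ (≐through B)) (Equivalence.from through-Below⇔≼ q≼q′))
  }
  where
  MaxAntichain : Set₁
  MaxAntichain = OrdStr.Car (AM (intervalPoset t))
  pointOf : MaxAntichain → Pt t
  pointOf (A , isMax) = proj₁ (maxAntichain⇒through lem A isMax)
  ≐through : (A : MaxAntichain) → proj₁ A ≐ through (pointOf A)
  ≐through (A , isMax) = proj₂ (maxAntichain⇒through lem A isMax)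

wellFounded⇒noDescent : ∀ {A : Set} {_<_ : A → A → Set} → WellFounded _<_ →
                        (f : ℕ → A) → ¬ (∀ n → f (suc n) < f n)
wellFounded⇒noDescent {_<_ = _<_} wf f descends = go 0 (wf (f 0))
  where
  go : ∀ n → Acc _<_ (f n) → ⊥
  go n (acc below) = go (suc n) (below (descends n))

noInjectionIntoList : ∀ {A : Set} (xs : List A) (f : ℕ → A) →
                      (∀ n → f n ∈ˡ xs) → ¬ (∀ m n → f m ≡ f n → m ≡ n)
noInjectionIntoList {A} xs f f∈xs injective
  with Finₚ.pigeonhole (ℕₚ.n<1+n (length xs)) (λ i → index (f∈xs (toℕ i)))
... | i , j , i<j , same-index =
  ℕₚ.<-irrefl (injective _ _ (Membershipₚ.index-injective (setoid A) (f∈xs _) (f∈xs _) same-index)) i<j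

≼-fst : ∀ {g a b} {x : Pt (g a)} {y : Pt (g b)} → (a , x) ≼[ node g ] (b , y) → a ℕ.≤ b
≼-fst (inj₁ (fst< p)) = ℕₚ.<⇒≤ p
≼-fst (inj₁ (snd< p)) = ℕₚ.≤-refl
≼-fst (inj₂ refl)     = ℕₚ.≤-refl

≼-snd : ∀ {g k} {x y : Pt (g k)} → (k , x) ≼[ node g ] (k , y) → x ≼[ g k ] y
≼-snd (inj₁ (fst< p)) = ⊥-elim (ℕₚ.<-irrefl refl p)
≼-snd (inj₁ (snd< p)) = inj₁ p
≼-snd (inj₂ e)        = inj₂ (,-injective e)

jumpsThrough : ∀ {t} → Pt t → List (Block t)
jumpsThrough {leaf}   _       = tt ∷ []
jumpsThrough {node g} (k , q) = (suc k , firstBlock) ∷ map (k ,_) (jumpsThrough q)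

jumpsThrough-complete : ∀ {t} (v : Block t) (q : Pt t) → jump v ∈ through q → v ∈ˡ jumpsThrough q
jumpsThrough-complete {leaf}   tt        q _ = here refl
jumpsThrough-complete {node g} (k′ , v) (k , q) (l≼q , q≼r) with prevBlock v in eq
... | just w with ℕₚ.≤-antisym (≼-fst l≼q) (≼-fst q≼r)
...   | refl = there (∈-map⁺ (k ,_) (jumpsThrough-complete v q (≼-snd l≼q′ , ≼-snd q≼r)))
  where
  l≼q′ : (k , jumpStart v) ≼[ node g ] (k , q)
  l≼q′ rewrite eq = l≼q
jumpsThrough-complete {node g} (zero , v) (k , q) (l≼q , q≼r) | nothing with ≼-fst q≼r
... | z≤n = there (∈-map⁺ (0 ,_) (jumpsThrough-complete v q (js≼q , ≼-snd q≼r)))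
  where
  js≼q : jumpStart v ≼[ g 0 ] q
  js≼q rewrite eq = ≼-snd l≼q
jumpsThrough-complete {node g} (suc k′ , v) (k , q) (l≼q , q≼r) | nothing
  with prevBlock≡nothing v eq | ℕₚ.m≤n⇒m<n∨m≡n (≼-fst l≼q)
... | refl | inj₂ refl = here refl
... | refl | inj₁ k′<k with ℕₚ.≤-antisym k′<k (≼-fst q≼r)
...   | refl = there (∈-map⁺ (k ,_) (jumpsThrough-complete firstBlock q (js≼q , ≼-snd q≼r)))
  where
  js≼q : jumpStart firstBlock ≼[ g k ] q
  js≼q rewrite jumpStart-firstBlock {g k} = least-≼ q

predecessors : ∀ {t} → Pt t → List (Pt t)
predecessors q with start-or-succ q
... | inj₁ _       = []
... | inj₂ (y , _) = y ∷ []

predecessors-succ : ∀ {t} (y : Pt t) → y ∈ˡ predecessors (succ y)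
predecessors-succ y with start-or-succ (succ y)
... | inj₁ (v , e)  = ⊥-elim (succ≢start y v e)
... | inj₂ (y′ , e) = here (succ-injective e)

throughList : ∀ {t} → Pt t → List (Elem t)
throughList q = unit q ∷ (map unit (predecessors q) ++ map jump (jumpsThrough q))

throughList-complete : ∀ {t} (q : Pt t) (c : Elem t) → c ∈ through q → c ∈ˡ throughList q
throughList-complete q (unit y) (inj₂ refl , _) = here refl
throughList-complete q (unit y) (inj₁ y≺q , q≼succ) with ≼-antisym (succ-≼ y≺q) q≼succ
... | refl = there (∈-++⁺ˡ (∈-map⁺ unit (predecessors-succ y)))
throughList-complete q (jump v) v∋q =
  there (∈-++⁺ʳ (map unit (predecessors q)) (∈-map⁺ jump (jumpsThrough-complete v q v∋q)))

isWQO : LEM → ∀ t → Pos.IsWQO (intervalPoset t)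
isWQO lem t = noDescent , noAntichain
  where
  open Pos (intervalPoset t) using (_<_; IsAntichain)
  noDescent : ¬ (Σ[ f ∈ (ℕ → Elem t) ] (∀ n → f (suc n) < f n))
  noDescent (f , descends) = wellFounded⇒noDescent (≺-wellFounded t) (right ∘ f) rightDescends
    where
    rightDescends : ∀ n → right (f (suc n)) ≺[ t ] right (f n)
    rightDescends n with descends n
    ... | inj₁ e , e≢ = ⊥-elim (e≢ e)
    ... | inj₂ p , _  = ≺-≼-trans p (left-≼-right (f n))
  noAntichain : ¬ (Σ[ f ∈ (ℕ → Elem t) ] (∀ m n → m ≢ n → ¬ (f m ⊑ f n)))
  noAntichain (f , incomparable) =
    noInjectionIntoList (throughList q) f
      (λ n → throughList-complete q (f n) (image⊆through (n , refl))) (λ m n e → ⊑⇒≡ m n (inj₁ e))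
    where
    ⊑⇒≡ : ∀ m n → f m ⊑ f n → m ≡ n
    ⊑⇒≡ m n fm⊑fn with m ℕₚ.≟ n
    ... | yes m≡n = m≡n
    ... | no m≢n  = ⊥-elim (incomparable m n m≢n fm⊑fn)
    image : Pred (Elem t) 0ℓ
    image c = ∃[ n ] f n ≡ c
    imageAntichain : IsAntichain image
    imageAntichain _ _ (m , refl) (n , refl) fm⊑fn = cong f (⊑⇒≡ m n fm⊑fn)
    q : Pt t
    q = proj₁ (antichain⊆through lem image imageAntichain (0 , refl))
    image⊆through : image ⊆ through q
    image⊆through = proj₂ (antichain⊆through lem image imageAntichain (0 , refl))

unit⋢unit-succ : ∀ {t} (x : Pt t) → ¬ unit x ⊑ unit (succ x)
unit⋢unit-succ x (inj₁ e) = ≺⇒≢ (≺-succ x) (cong left e)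
unit⋢unit-succ x (inj₂ p) = ≺-irrefl p

jump⋢unit-start : ∀ {t} (v : Block t) → ¬ jump v ⊑ unit (start v)
jump⋢unit-start v (inj₂ p) = ≺-irrefl p

unit⋢jump : ∀ {t} {y : Pt t} (v : Block t) → jumpStart v ≼[ t ] y → ¬ unit y ⊑ jump v
unit⋢jump {y = y} v js≼y (inj₂ p) = ≺⇒⋡ (≺-trans (≺-succ y) p) js≼y

module Primality (lem : LEM) {t : Tree} (A : Pred (Elem t) 0ℓ)
                 (isModule : Pos.IsModule (intervalPoset t) A) where

  inA-if-above : ∀ {a a′ z} → a ∈ A → a′ ∈ A → a ⊑ z → (a′ ⊑ z → z ∈ A) → z ∈ A
  inA-if-above {a} {a′} {z} a∈A a′∈A a⊑z a′⊑z⇒z∈A with lem {P = z ∈ A}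
  ... | yes z∈A = z∈A
  ... | no z∉A  = a′⊑z⇒z∈A (Equivalence.to (proj₂ (isModule a a′ z a∈A a′∈A z∉A)) a⊑z)

  inA-if-below : ∀ {a a′ z} → a ∈ A → a′ ∈ A → z ⊑ a → (z ⊑ a′ → z ∈ A) → z ∈ A
  inA-if-below {a} {a′} {z} a∈A a′∈A z⊑a z⊑a′⇒z∈A with lem {P = z ∈ A}
  ... | yes z∈A = z∈A
  ... | no z∉A  = z⊑a′⇒z∈A (Equivalence.to (proj₁ (isModule a a′ z a∈A a′∈A z∉A)) z⊑a)

  PairAt : Pt t → Set
  PairAt x = unit x ∈ A × unit (succ x) ∈ A

  pairAt-succ : ∀ {x} → PairAt x → PairAt (succ x)
  pairAt-succ {x} (x∈A , sx∈A) =
    sx∈A , inA-if-above x∈A sx∈A (inj₂ (succ-mono (≺-succ x))) (⊥-elim ∘ unit⋢unit-succ (succ x))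

  pairAt-pred : ∀ {x} → PairAt (succ x) → PairAt x
  pairAt-pred {x} (sx∈A , ssx∈A) =
    inA-if-below ssx∈A sx∈A (inj₂ (succ-mono (≺-succ x))) (⊥-elim ∘ unit⋢unit-succ x) , sx∈A

  pairAt-+ₚ : ∀ {x} m → PairAt x → PairAt (x +ₚ m)
  pairAt-+ₚ zero    p = p
  pairAt-+ₚ (suc m) p = pairAt-succ (pairAt-+ₚ m p)

  pairAt-∸ₚ : ∀ {x} n → PairAt (x +ₚ n) → PairAt x
  pairAt-∸ₚ zero    p = p
  pairAt-∸ₚ (suc n) p = pairAt-∸ₚ n (pairAt-pred p)

  BlockInA : Block t → Set
  BlockInA v = ∀ m → unit (start v +ₚ m) ∈ A

  pairAt⇒blockInA : ∀ v n → PairAt (start v +ₚ n) → BlockInA v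
  pairAt⇒blockInA v n p m = proj₁ (pairAt-+ₚ m (pairAt-∸ₚ n p))

  jumpInA : ∀ v → unit (start v) ∈ A → unit (succ (start v)) ∈ A → jump v ∈ A
  jumpInA v s∈A ss∈A = inA-if-below ss∈A s∈A (inj₂ (≺-succ (start v))) (⊥-elim ∘ jump⋢unit-start v)

  consecutiveUnits : ∀ {a a′} → a ∈ A → a′ ∈ A → right a ≺[ t ] right a′ → PairAt (succ (right a))
  consecutiveUnits {a} {a′} a∈A a′∈A ra≺ra′ =
    y∈A , inA-if-above a∈A y∈A (inj₂ ra≺sy) (⊥-elim ∘ unit⋢unit-succ _)
    where
    ra≺sy : right a ≺[ t ] succ (succ (right a))
    ra≺sy = ≺-trans (≺-succ _) (≺-succ _)
    y∈A : unit (succ (right a)) ∈ A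
    y∈A = inA-if-above a∈A a′∈A (inj₂ (≺-succ _)) a′⊑y⇒y∈A
      where
      a′⊑y⇒y∈A : a′ ⊑ unit (succ (right a)) → unit (succ (right a)) ∈ A
      a′⊑y⇒y∈A (inj₁ refl) = a′∈A
      a′⊑y⇒y∈A (inj₂ p)    = ⊥-elim (≺⇒⋡ p (succ-≼ ra≺ra′))

  firstBlockInA : ∀ v → BlockInA v → BlockInA firstBlock
  firstBlockInA v = go v (≺-wellFounded t (start v))
    where
    go : ∀ v → Acc (Lt t) (start v) → BlockInA v → BlockInA firstBlock
    go v (acc below) v∈A with jumpView v
    ... | first refl = v∈A
    ... | after w eq js = go w (below (prevBlock-≺ v w eq 0)) (pairAt⇒blockInA w 2 (w2∈A , w3∈A))
      -- jump v starts at start w +ₚ 2, so it meets the units there and at start w +ₚ 3,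
      -- while both lie below unit (start v).
      where
      jv∈A : jump v ∈ A
      jv∈A = jumpInA v (v∈A 0) (v∈A 1)
      w2∈A : unit (start w +ₚ 2) ∈ A
      w2∈A = inA-if-below (v∈A 0) jv∈A (inj₂ (prevBlock-≺ v w eq 3))
                          (⊥-elim ∘ unit⋢jump v (inj₂ js))
      js≺w3 : jumpStart v ≺[ t ] start w +ₚ 3
      js≺w3 rewrite js = ≺-succ _
      w3∈A : unit (start w +ₚ 3) ∈ A
      w3∈A = inA-if-below (v∈A 0) jv∈A (inj₂ (prevBlock-≺ v w eq 4))
                          (⊥-elim ∘ unit⋢jump v (inj₁ js≺w3))

  allUnitsInA : PairAt least → ∀ x → unit x ∈ A
  allUnitsInA (least∈A , sleast∈A) x = go x (≺-wellFounded t x)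
    where
    go : ∀ x → Acc (Lt t) x → unit x ∈ A
    go x (acc below) with start-or-succ x
    ... | inj₂ (y , refl) with least-≼ y
    ...   | inj₂ refl = sleast∈A
    ...   | inj₁ l≺y  = inA-if-above least∈A (go y (below (≺-succ y))) (inj₂ (succ-mono l≺y))
                                     (⊥-elim ∘ unit⋢unit-succ y)
    go x (acc below) | inj₁ (v , refl) with jumpView v
    ... | first refl = least∈A
    ... | after w eq js =
      inA-if-above least∈A jv∈A (inj₂ (≺-trans sl≺js js≺s)) (⊥-elim ∘ jump⋢unit-start v)
      where
      v≢first : v ≢ firstBlock
      v≢first refl with trans (sym eq) prevBlock-firstBlock
      ... | ()
      sl≺js : succ least ≺[ t ] jumpStart v
      sl≺js = succ-least-≺-jumpStart v v≢first
      js≺s : jumpStart v ≺[ t ] start v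
      js≺s = subst (λ z → z ≺[ t ] start v) (sym js) (prevBlock-≺ v w eq 2)
      jv∈A : jump v ∈ A
      jv∈A = inA-if-above least∈A (go (jumpStart v) (below js≺s)) (inj₂ sl≺js)
                          (⊥-elim ∘ unit⋢jump v (inj₂ refl))

  pairAt⇒pairAtLeast : ∀ y → PairAt y → PairAt least
  pairAt⇒pairAtLeast y p = first∈A 0 , first∈A 1
    where
    first∈A : BlockInA firstBlock
    first∈A = firstBlockInA (blockOf y)
                (pairAt⇒blockInA (blockOf y) (offset y) (subst PairAt (sym (start-+ₚ-offset y)) p))

  everythingInA : ∀ {a a′} → a ∈ A → a′ ∈ A → a ≢ a′ → ∀ c → c ∈ A
  everythingInA {a} {a′} a∈A a′∈A a≢a′ =
    allInA (pairAt⇒pairAtLeast (proj₁ pairSomewhere) (proj₂ pairSomewhere))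
    where
    pairSomewhere : ∃[ y ] PairAt y
    pairSomewhere with ≺-compare t (right a) (right a′)
    ... | tri< a≺a′ _ _ = _ , consecutiveUnits a∈A a′∈A a≺a′
    ... | tri≈ _ e _    = ⊥-elim (a≢a′ (right-injective e))
    ... | tri> _ _ a′≺a = _ , consecutiveUnits a′∈A a∈A a′≺a
    allInA : PairAt least → ∀ c → c ∈ A
    allInA p (unit x) = allUnitsInA p x
    allInA p (jump v) = jumpInA v (allUnitsInA p (start v)) (allUnitsInA p (succ (start v)))

isPrime : LEM → ∀ t → Pos.IsPrime (intervalPoset t)
isPrime lem t A isModule with lem {P = ∃[ c ] c ∈ A}
... | no ¬inhabited = inj₁ (λ c c∈A → ¬inhabited (c , c∈A))
... | yes (a , a∈A) with lem {P = ∃[ c ] (c ∈ A × c ≢ a)}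
...   | yes (_ , a′∈A , a′≢a) = inj₂ (inj₂ (Primality.everythingInA lem A isModule a′∈A a∈A a′≢a))
...   | no ¬other = inj₂ (inj₁ (a , λ c → mk⇔ (c∈A⇒c≡a c) λ { refl → a∈A }))
  where
  c∈A⇒c≡a : ∀ c → c ∈ A → c ≡ a
  c∈A⇒c≡a c c∈A with lem {P = c ≡ a}
  ... | yes c≡a = c≡a
  ... | no c≢a  = ⊥-elim (¬other (c , c∈A , c≢a))

-- In  i <[ J ] j  the index J is ignored, so it cannot determine the type of i and j.
LtIdx LeIdx : (I : Idx) → ⟦ I ⟧ → ⟦ I ⟧ → Set
LtIdx I i j = _<[_]_ {I} i I j
LeIdx I i j = LtIdx I i j ⊎ i ≡ j

infix 4 LtIdx LeIdx
syntax LtIdx I i j = i <ⁱ[ I ] j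
syntax LeIdx I i j = i ≤ⁱ[ I ] j

<ⁱ-irrefl : ∀ I {i : ⟦ I ⟧} → ¬ i <ⁱ[ I ] i
<ⁱ-irrefl (fin n) = ℕₚ.<-irrefl refl
<ⁱ-irrefl omega   = ℕₚ.<-irrefl refl
<ⁱ-irrefl omega*  = ℕₚ.<-irrefl refl
<ⁱ-irrefl zed     = ℤₚ.<-irrefl refl

<ⁱ-asym : ∀ I {i j : ⟦ I ⟧} → i <ⁱ[ I ] j → ¬ j <ⁱ[ I ] i
<ⁱ-asym (fin n) = ℕₚ.<-asym
<ⁱ-asym omega   = ℕₚ.<-asym
<ⁱ-asym omega*  = ℕₚ.<-asym
<ⁱ-asym zed     = ℤₚ.<-asym

≤ⁱ-antisym : ∀ I {i j : ⟦ I ⟧} → i ≤ⁱ[ I ] j → j ≤ⁱ[ I ] i → i ≡ j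
≤ⁱ-antisym I (inj₂ e) _        = e
≤ⁱ-antisym I (inj₁ p) (inj₂ e) = sym e
≤ⁱ-antisym I (inj₁ p) (inj₁ q) = ⊥-elim (<ⁱ-asym I p q)

EventuallyConstant : ∀ {A : Set} → (ℕ → A) → Set
EventuallyConstant s = ∃[ k₀ ] ∀ k → k₀ ℕ.≤ k → s k ≡ s k₀

-- The sequence settles at the place where it attains its least value.
antitone⇒eventuallyConstant : LEM → (s : ℕ → ℕ) → (∀ k → s (suc k) ℕ.≤ s k) →
                              EventuallyConstant s
antitone⇒eventuallyConstant lem s s↓ with minimal lem <-wellFounded (λ v → ∃[ k ] s k ≡ v) (0 , refl)
... | _ , (k₀ , refl) , minimum =
  k₀ , λ k k₀≤k → ℕₚ.≤-antisym (antitone (ℕₚ.≤⇒≤′ k₀≤k)) (ℕₚ.≮⇒≥ (minimum (k , refl)))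
  where
  antitone : ∀ {i j} → i ℕ.≤′ j → s j ℕ.≤ s i
  antitone ℕ.≤′-refl      = ℕₚ.≤-refl
  antitone (ℕ.≤′-step i≤j) = ℕₚ.≤-trans (s↓ _) (antitone i≤j)

eventuallyConstant-reflect : ∀ {A : Set} {s : ℕ → A} (μ : A → ℕ) →
                             (∀ i j → μ (s i) ≡ μ (s j) → s i ≡ s j) →
                             EventuallyConstant (μ ∘ s) → EventuallyConstant s
eventuallyConstant-reflect μ injective (k₀ , const) = k₀ , λ k k₀≤k → injective k k₀ (const k k₀≤k)

monotone-bounded⇒eventuallyConstantℕ : LEM → (s : ℕ → ℕ) (u : ℕ) →
  (∀ k → s k ℕ.≤ s (suc k)) → (∀ k → s k ℕ.≤ u) → EventuallyConstant s
monotone-bounded⇒eventuallyConstantℕ lem s u s↑ s≤u =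
  eventuallyConstant-reflect (u ∸_) (λ i j → ℕₚ.∸-cancelˡ-≡ (s≤u i) (s≤u j))
    (antitone⇒eventuallyConstant lem (λ k → u ∸ s k) (λ k → ℕₚ.∸-monoʳ-≤ u (s↑ k)))

+∣u-a∣≡u-a : ∀ {u a} → a ℤ.≤ u → ℤ.+ ℤ.∣ u ℤ.- a ∣ ≡ u ℤ.- a
+∣u-a∣≡u-a a≤u = ℤₚ.0≤i⇒+∣i∣≡i (ℤₚ.i≤j⇒0≤j-i a≤u)

monotone-bounded⇒eventuallyConstant : LEM → ∀ I (s : ℕ → ⟦ I ⟧) (u : ⟦ I ⟧) →
  (∀ k → s k ≤ⁱ[ I ] s (suc k)) → (∀ k → s k ≤ⁱ[ I ] u) → EventuallyConstant s
monotone-bounded⇒eventuallyConstant lem (fin n) s u s↑ s≤u =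
  eventuallyConstant-reflect toℕ (λ _ _ → Finₚ.toℕ-injective)
    (monotone-bounded⇒eventuallyConstantℕ lem (toℕ ∘ s) (toℕ u) (≤ⁱ⇒≤ ∘ s↑) (≤ⁱ⇒≤ ∘ s≤u))
  where
  ≤ⁱ⇒≤ : ∀ {i j : Fin n} → i ≤ⁱ[ fin n ] j → toℕ i ℕ.≤ toℕ j
  ≤ⁱ⇒≤ (inj₁ p)    = ℕₚ.<⇒≤ p
  ≤ⁱ⇒≤ (inj₂ refl) = ℕₚ.≤-refl
monotone-bounded⇒eventuallyConstant lem omega s u s↑ s≤u =
  monotone-bounded⇒eventuallyConstantℕ lem s u (≤ⁱ⇒≤ ∘ s↑) (≤ⁱ⇒≤ ∘ s≤u)
  where
  ≤ⁱ⇒≤ : ∀ {i j : ℕ} → i ≤ⁱ[ omega ] j → i ℕ.≤ j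
  ≤ⁱ⇒≤ (inj₁ p)    = ℕₚ.<⇒≤ p
  ≤ⁱ⇒≤ (inj₂ refl) = ℕₚ.≤-refl
monotone-bounded⇒eventuallyConstant lem omega* s u s↑ s≤u =
  antitone⇒eventuallyConstant lem s (≤ⁱ⇒≥ ∘ s↑)
  where
  ≤ⁱ⇒≥ : ∀ {i j : ℕ} → i ≤ⁱ[ omega* ] j → j ℕ.≤ i
  ≤ⁱ⇒≥ (inj₁ p)    = ℕₚ.<⇒≤ p
  ≤ⁱ⇒≥ (inj₂ refl) = ℕₚ.≤-refl
monotone-bounded⇒eventuallyConstant lem zed s u s↑ s≤u =
  eventuallyConstant-reflect (λ a → ℤ.∣ u ℤ.- a ∣) injective
    (antitone⇒eventuallyConstant lem (λ k → ℤ.∣ u ℤ.- s k ∣) antitone)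
  where
  open +-*-Solver using (solve; _:=_; _:-_)
  ≤ⁱ⇒≤ : ∀ {i j : ℤ} → i ≤ⁱ[ zed ] j → i ℤ.≤ j
  ≤ⁱ⇒≤ (inj₁ p)    = ℤₚ.<⇒≤ p
  ≤ⁱ⇒≤ (inj₂ refl) = ℤₚ.≤-refl
  u-[u-a]≡a : ∀ a → u ℤ.- (u ℤ.- a) ≡ a
  u-[u-a]≡a = solve 2 (λ u a → u :- (u :- a) := a) refl u
  antitone : ∀ k → ℤ.∣ u ℤ.- s (suc k) ∣ ℕ.≤ ℤ.∣ u ℤ.- s k ∣
  antitone k = ℤₚ.drop‿+≤+ (subst₂ ℤ._≤_ (sym (+∣u-a∣≡u-a (≤ⁱ⇒≤ (s≤u (suc k)))))
                                        (sym (+∣u-a∣≡u-a (≤ⁱ⇒≤ (s≤u k))))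
                                        (ℤₚ.+-monoʳ-≤ u (ℤₚ.neg-mono-≤ (≤ⁱ⇒≤ (s↑ k)))))
  injective : ∀ i j → ℤ.∣ u ℤ.- s i ∣ ≡ ℤ.∣ u ℤ.- s j ∣ → s i ≡ s j
  injective i j e = begin
    s i                 ≡⟨ sym (u-[u-a]≡a (s i)) ⟩
    u ℤ.- (u ℤ.- s i)   ≡⟨ cong (λ z → u ℤ.- z) u-si≡u-sj ⟩
    u ℤ.- (u ℤ.- s j)   ≡⟨ u-[u-a]≡a (s j) ⟩
    s j                 ∎
    where
    open ≡-Reasoning
    u-si≡u-sj : u ℤ.- s i ≡ u ℤ.- s j
    u-si≡u-sj = begin
      u ℤ.- s i               ≡⟨ sym (+∣u-a∣≡u-a (≤ⁱ⇒≤ (s≤u i))) ⟩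
      ℤ.+ ℤ.∣ u ℤ.- s i ∣     ≡⟨ cong ℤ.+_ e ⟩
      ℤ.+ ℤ.∣ u ℤ.- s j ∣     ≡⟨ +∣u-a∣≡u-a (≤ⁱ⇒≤ (s≤u j)) ⟩
      u ℤ.- s j               ∎

-- Cantor's enumeration of ℕ × ℕ along the antidiagonals a + b = d.
nextPair : ℕ × ℕ → ℕ × ℕ
nextPair (a , suc b) = suc a , b
nextPair (a , zero)  = zero , suc a

unpair : ℕ → ℕ × ℕ
unpair zero    = 0 , 0
unpair (suc k) = nextPair (unpair k)

unpair-surjective : ∀ d a b → a + b ≡ d → ∃[ k ] unpair k ≡ (a , b)
unpair-surjective d (suc a) b a+b≡d with unpair-surjective d a (suc b) (trans (ℕₚ.+-suc a b) a+b≡d)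
... | k , e = suc k , cong nextPair e
unpair-surjective (suc d) zero (suc b) b+1≡d+1
  with unpair-surjective d b zero (trans (ℕₚ.+-identityʳ b) (ℕₚ.suc-injective b+1≡d+1))
... | k , e = suc k , cong nextPair e
unpair-surjective zero zero zero _ = 0 , refl

unpair-≤ : ∀ k → proj₁ (unpair k) + proj₂ (unpair k) ℕ.≤ k
unpair-≤ zero = z≤n
unpair-≤ (suc k) with unpair k | unpair-≤ k
... | a , suc b | a+b≤k = ℕₚ.m≤n⇒m≤1+n (subst (ℕ._≤ k) (ℕₚ.+-suc a b) a+b≤k)
... | a , zero  | a+0≤k = s≤s (subst (ℕ._≤ k) (ℕₚ.+-identityʳ a) a+0≤k)

enum : ℕ → ℕ
enum k = proj₁ (unpair k)

enum-infinitelyOften : ∀ n k₀ → ∃[ k ] (k₀ ℕ.≤ k × enum k ≡ n)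
enum-infinitelyOften n k₀ with unpair-surjective (n + k₀) n k₀ refl
... | k , e = k , ℕₚ.≤-trans (ℕₚ.m≤n+m k₀ n) (subst (λ p → proj₁ p + proj₂ p ℕ.≤ k) e (unpair-≤ k))
                , cong proj₁ e

-- Limits repeat every f n infinitely often, so that any tail of the blocks of
-- ordTree (olim f) still contains a copy of each ordTree (f n).
ordTree : Ord → Tree
ordTree ozero    = leaf
ordTree (osuc α) = node (λ _ → ordTree α)
ordTree (olim f) = node (λ k → ordTree (f (enum k)))

Strict : (C : OrdStr) → OrdStr.Car C → OrdStr.Car C → Set
Strict C a b = OrdStr._≤_ C a b × ¬ OrdStr._≤_ C b a

infix 4 _↪_ _↪ᵗ_
record _↪_ (t : Tree) (C : OrdStr) : Set₁ where
  constructor mk↪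
  field
    apply  : Pt t → OrdStr.Car C
    strict : ∀ {x y} → x ≺[ t ] y → Strict C (apply x) (apply y)

record _↪ᵗ_ (s t : Tree) : Set where
  constructor mk↪ᵗ
  field
    applyᵗ : Pt s → Pt t
    mono   : ∀ {x y} → x ≺[ s ] y → applyᵗ x ≺[ t ] applyᵗ y

open _↪_ public
open _↪ᵗ_ public

↪ᵗ-↪-trans : ∀ {s t C} → s ↪ᵗ t → t ↪ C → s ↪ C
↪ᵗ-↪-trans φ ψ = mk↪ (apply ψ ∘ applyᵗ φ) (strict ψ ∘ mono φ)

↪-≅ : ∀ {t C D} → C ≅ D → t ↪ C → t ↪ D
↪-≅ {C = C} {D} C≅D φ = mk↪ (to ∘ apply φ) (preserve ∘ strict φ)
  where
  open _≅_ C≅D using (to)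
  preserve : ∀ {a b} → Strict C a b → Strict D (to a) (to b)
  preserve {a} {b} (a≤b , b≰a) =
    Equivalence.to (_≅_.mono C≅D a b) a≤b , b≰a ∘ Equivalence.from (_≅_.mono C≅D b a)

inBlock : ∀ {g} k → g k ↪ᵗ node g
inBlock k = mk↪ᵗ (k ,_) snd<

inTail : ∀ {g} k₀ → node (λ m → g (k₀ + m)) ↪ᵗ node g
inTail k₀ = mk↪ᵗ (λ { (m , x) → k₀ + m , x }) λ where
  (fst< m<m′) → fst< (ℕₚ.+-monoʳ-< k₀ m<m′)
  (snd< x≺y)  → snd< x≺y

nodeMap : ∀ {g h} → (∀ k → g k ↪ᵗ h k) → node g ↪ᵗ node h
nodeMap e = mk↪ᵗ (λ { (k , x) → k , applyᵗ (e k) x }) λ where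
  (fst< k<k′) → fst< k<k′
  (snd< x≺y)  → snd< (mono (e _) x≺y)

module Summands (I : Idx) (D : ⟦ I ⟧ → OrdStr) where

  Σ-chain : OrdStr
  Σ-chain = LinSum I D

  Point : Set₁
  Point = OrdStr.Car Σ-chain

  idx : Point → ⟦ I ⟧
  idx p = lower (proj₁ p)

  idx-mono : ∀ {p q} → OrdStr._≤_ Σ-chain p q → idx p ≤ⁱ[ I ] idx q
  idx-mono (inj₁ i<j)       = inj₁ i<j
  idx-mono (inj₂ (i≡j , _)) = inj₂ i≡j

  BoundedBy : ∀ {t} → t ↪ Σ-chain → Point → Set
  BoundedBy φ p = ∀ x → Strict Σ-chain (apply φ x) p

  ↪-summand : ∀ {t} j (φ : t ↪ Σ-chain) → (∀ x → idx (apply φ x) ≡ j) → t ↪ D j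
  ↪-summand j φ inj =
    mk↪ (λ x → component (apply φ x) (inj x))
        (λ {x} {y} x≺y → preserve (apply φ x) (apply φ y) (inj x) (inj y) (strict φ x≺y))
    where
    component : (p : Point) → idx p ≡ j → OrdStr.Car (D j)
    component (_ , a) refl = a
    preserve : (p q : Point) (p∈j : idx p ≡ j) (q∈j : idx q ≡ j) → Strict Σ-chain p q →
               Strict (D j) (component p p∈j) (component q q∈j)
    preserve (_ , a) (_ , b) refl refl (inj₁ j<j , _)            = ⊥-elim (<ⁱ-irrefl I j<j)
    preserve (_ , a) (_ , b) refl refl (inj₂ (refl , a≤b) , b≰a) = a≤b , λ b≤a → b≰a (inj₂ (refl , b≤a))

  -- The blocks of a bounded copy of node g enter summands monotonically, so by
  -- stabilisation in the rank-0 index chain a tail of them lies in a single summand.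
  tail-in-one-summand : LEM → ∀ {g} (φ : node g ↪ Σ-chain) {p} → BoundedBy φ p →
                        ∃[ j ] ∃[ k₀ ] ∀ k → k₀ ℕ.≤ k → ∀ x → idx (apply φ (k , x)) ≡ j
  tail-in-one-summand lem φ {p} bounded
    with monotone-bounded⇒eventuallyConstant lem I firstIdx (idx p) firstIdx-mono
           (λ k → idx-mono (proj₁ (bounded _)))
    where
    firstIdx : ℕ → ⟦ I ⟧
    firstIdx k = idx (apply φ (k , least))
    firstIdx-mono : ∀ k → firstIdx k ≤ⁱ[ I ] firstIdx (suc k)
    firstIdx-mono k = idx-mono (proj₁ (strict φ (fst< (ℕₚ.n<1+n k))))
  ... | k₀ , const =
    idx (apply φ (k₀ , least)) , k₀ , λ k k₀≤k x → ≤ⁱ-antisym I (up k k₀≤k x) (down k k₀≤k x)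
    where
    up : ∀ k → k₀ ℕ.≤ k → ∀ x → idx (apply φ (k , x)) ≤ⁱ[ I ] idx (apply φ (k₀ , least))
    up k k₀≤k x = subst (LeIdx I _) (const (suc k) (ℕₚ.m≤n⇒m≤1+n k₀≤k))
                        (idx-mono (proj₁ (strict φ (fst< (ℕₚ.n<1+n k)))))
    down : ∀ k → k₀ ℕ.≤ k → ∀ x → idx (apply φ (k₀ , least)) ≤ⁱ[ I ] idx (apply φ (k , x))
    down k k₀≤k x with least-≼ x
    ... | inj₁ l≺x  = subst (λ i → i ≤ⁱ[ I ] idx (apply φ (k , x))) (const k k₀≤k)
                            (idx-mono (proj₁ (strict φ (snd< l≺x))))
    ... | inj₂ refl = inj₂ (sym (const k k₀≤k))

rank0-noBoundedAscent : LEM → ∀ I (s : ℕ → ⟦ I ⟧) u →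
                        (∀ k → s k <ⁱ[ I ] s (suc k)) → ¬ (∀ k → s k ≤ⁱ[ I ] u)
rank0-noBoundedAscent lem I s u s↑ s≤u
  with monotone-bounded⇒eventuallyConstant lem I s u (inj₁ ∘ s↑) s≤u
... | k₀ , const = <ⁱ-irrefl I (subst (λ i → s k₀ <ⁱ[ I ] i) (const (suc k₀) (ℕₚ.n≤1+n k₀)) (s↑ k₀))

rank0-noCopyOfNode : LEM → ∀ I {g} → ¬ (node g ↪ Concrete I)
rank0-noCopyOfNode lem I φ =
  rank0-noBoundedAscent lem I s (lower (apply φ (1 , least)))
    (λ k → strict< (strict φ (snd< (≺-succ _))))
    (λ k → inj₁ (strict< (strict φ (fst< (s≤s z≤n)))))
  where
  strict< : ∀ {a b} → Strict (Concrete I) a b → lower a <ⁱ[ I ] lower b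
  strict< (inj₁ a<b , _)   = a<b
  strict< (inj₂ a≡b , b≰a) = ⊥-elim (b≰a (inj₂ (sym a≡b)))
  s : ℕ → ⟦ I ⟧
  s k = lower (apply φ (0 , least +ₚ k))

module _ (lem : LEM) (I : Idx) (D : ⟦ I ⟧ → OrdStr) (β : ⟦ I ⟧ → Ord)
         (noCopyInSummand : ∀ j γ → β j <ₒ γ → ¬ (ordTree γ ↪ D j)) where
  open Summands I D

  noBoundedCopy : ∀ ε → (∀ j → β j <ₒ ε) → (φ : ordTree ε ↪ Σ-chain) → ∀ {p} → ¬ BoundedBy φ p
  noBoundedCopy ozero β<ε φ _ with β<ε (idx (apply φ 0))
  ... | ()
  noBoundedCopy (osuc ε) β<ε φ bounded with tail-in-one-summand lem φ bounded
  ... | j , k₀ , inj = noCopyInSummand j (osuc ε) (β<ε j)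
    (↪-summand j (↪ᵗ-↪-trans (inTail k₀) φ) λ { (m , x) → inj (k₀ + m) (ℕₚ.m≤m+n k₀ m) x })
  noBoundedCopy (olim f) β<ε φ bounded with tail-in-one-summand lem φ bounded
  ... | j , k₀ , inj with <ₒ-olim-inv (β<ε j)
  ...   | n , βj<fn with enum-infinitelyOften n k₀
  ...     | k , k₀≤k , refl = noCopyInSummand j (f (enum k)) βj<fn
    (↪-summand j (↪ᵗ-↪-trans (inBlock k) φ) (inj k k₀≤k))

  -- A block of ordTree γ whose code is at least β₀ is bounded by the first point of the next block.
  noCopy : ∀ {β₀} → (∀ j → β j <ₒ β₀) → ∀ γ → β₀ <ₒ γ → ¬ (ordTree γ ↪ Σ-chain)
  noCopy β<β₀ (osuc δ) β₀<γ φ =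
    noBoundedCopy δ (λ j → ≤ₒ-trans (β<β₀ j) (osuc-≤ₒ-inv β₀<γ)) (↪ᵗ-↪-trans (inBlock 0) φ)
                  {apply φ (1 , least)} (λ x → strict φ (fst< (s≤s z≤n)))
  noCopy β<β₀ (olim f) β₀<γ φ with <ₒ-olim-inv β₀<γ
  ... | n , β₀<fn with enum-infinitelyOften n 0
  ...   | k , _ , refl =
    noBoundedCopy (f (enum k)) (λ j → ≤ₒ-trans (β<β₀ j) (<ₒ⇒≤ₒ β₀<fn)) (↪ᵗ-↪-trans (inBlock k) φ)
                  {apply φ (suc k , least)} (λ x → strict φ (fst< (ℕₚ.n<1+n k)))

rank-lowerBound : LEM → ∀ {β C} → RankLe β C → ∀ γ → β <ₒ γ → ¬ (ordTree γ ↪ C)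
rank-lowerBound lem (base (I , C≅I))    (osuc δ) _   φ = rank0-noCopyOfNode lem I (↪-≅ C≅I φ)
rank-lowerBound lem (base (I , C≅I))    (olim f) _   φ = rank0-noCopyOfNode lem I (↪-≅ C≅I φ)
rank-lowerBound lem (sum I D ranks C≅Σ) γ        β<γ φ =
  noCopy lem I D (proj₁ ∘ ranks) (λ j → rank-lowerBound lem (proj₂ (proj₂ (ranks j))))
         (proj₁ ∘ proj₂ ∘ ranks) γ β<γ (↪-≅ C≅Σ φ)

leaf≅ω : chainStr leaf ≅ Concrete omega
leaf≅ω = record
  { to = λ { (lift n) → lift n }
  ; from = λ { (lift n) → lift n }
  ; to-cong = λ e → e
  ; from-cong = λ e → e
  ; from-to = λ _ → refl
  ; to-from = λ _ → refl
  ; mono = λ _ _ → mk⇔ (λ { (inj₁ (leaf< m<n)) → inj₁ m<n ; (inj₂ e) → inj₂ e })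
                      (λ { (inj₁ m<n) → inj₁ (leaf< m<n) ; (inj₂ e) → inj₂ e })
  }

node≅Σ : ∀ g → chainStr (node g) ≅ LinSum omega (chainStr ∘ g)
node≅Σ g = record
  { to = λ { (lift (k , x)) → lift k , lift x }
  ; from = λ { (lift k , lift x) → lift (k , x) }
  ; to-cong = λ { refl → refl , refl }
  ; from-cong = λ { (refl , refl) → refl }
  ; from-to = λ _ → refl
  ; to-from = λ _ → refl , refl
  ; mono = λ _ _ → mk⇔ to≤ from≤
  }
  where
  Σ≤ : ∀ {k k′} → Pt (g k) → Pt (g k′) → Set
  Σ≤ {k} {k′} x x′ =
    k ℕ.< k′ ⊎ Σ[ e ∈ k ≡ k′ ] (lower (subst (λ k → Lift (lsuc 0ℓ) (Pt (g k))) e (lift x)) ≼[ g k′ ] x′)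
  to≤ : ∀ {k k′} {x : Pt (g k)} {x′ : Pt (g k′)} → (k , x) ≼[ node g ] (k′ , x′) → Σ≤ x x′
  to≤ (inj₁ (fst< k<k′)) = inj₁ k<k′
  to≤ (inj₁ (snd< x≺x′)) = inj₂ (refl , inj₁ x≺x′)
  to≤ (inj₂ refl)        = inj₂ (refl , inj₂ refl)
  from≤ : ∀ {k k′} {x : Pt (g k)} {x′ : Pt (g k′)} → Σ≤ x x′ → (k , x) ≼[ node g ] (k′ , x′)
  from≤ (inj₁ k<k′)                = inj₁ (fst< k<k′)
  from≤ (inj₂ (refl , inj₁ x≺x′)) = inj₁ (snd< x≺x′)
  from≤ (inj₂ (refl , inj₂ refl))  = inj₂ refl

≅-trans-chain : ∀ {C X} t → C ≅ chainStr t → chainStr t ≅ X → C ≅ X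
≅-trans-chain {C} {X} t C≅t t≅X = record
  { to = λ c → F₂.to (F₁.to c)
  ; from = λ x → F₁.from (F₂.from x)
  ; to-cong = λ e → F₂.to-cong (F₁.to-cong e)
  ; from-cong = λ e → F₁.from-cong (F₂.from-cong e)
  ; from-to = λ c →
      subst (λ p → OrdStr._≈_ C (F₁.from p) c) (sym (cong lift (F₂.from-to (F₁.to c)))) (F₁.from-to c)
  ; to-from = λ x →
      subst (λ p → OrdStr._≈_ X (F₂.to p) x) (sym (cong lift (F₁.to-from (F₂.from x)))) (F₂.to-from x)
  ; mono = λ c c′ → mk⇔ (Equivalence.to (F₂.mono _ _) ∘ Equivalence.to (F₁.mono c c′))
                        (Equivalence.from (F₁.mono c c′) ∘ Equivalence.from (F₂.mono _ _))
  }
  where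
  module F₁ = _≅_ C≅t
  module F₂ = _≅_ t≅X

RankLe-≅ : ∀ {α C} t → C ≅ chainStr t → RankLe α (chainStr t) → RankLe α C
RankLe-≅ t C≅t (base (I , t≅I))      = base (I , ≅-trans-chain t C≅t t≅I)
RankLe-≅ t C≅t (sum I D ranks t≅Σ) = sum I D ranks (≅-trans-chain t C≅t t≅Σ)

RankLe-mono : ∀ {α α′ C} → α ≤ₒ α′ → RankLe α C → RankLe α′ C
RankLe-mono α≤α′ (base C≅I)          = base C≅I
RankLe-mono α≤α′ (sum I D ranks C≅Σ) =
  sum I D (λ j → let β , β<α , rank≤β = ranks j in β , ≤ₒ-trans β<α α≤α′ , rank≤β) C≅Σ

¬∃¬⇒∀ : LEM → ∀ {P : ℕ → Set} → ¬ (∃[ n ] ¬ P n) → ∀ n → P n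
¬∃¬⇒∀ lem {P} ¬∃ n with lem {P = P n}
... | yes p = p
... | no ¬p = ⊥-elim (¬∃ (n , ¬p))

olim-≤ₒ : LEM → ∀ f n → ¬ (f n <ₒ olim f) → olim f ≤ₒ f n
olim-≤ₒ lem f n ¬fn<lim = lim≤ₒ λ m → fm≤fn (≤ₒ-or->ₒ lem (f m) (f n))
  where
  fm≤fn : ∀ {m} → f m ≤ₒ f n ⊎ f n <ₒ f m → f m ≤ₒ f n
  fm≤fn (inj₁ fm≤fn) = fm≤fn
  fm≤fn {m} (inj₂ fn<fm) = ⊥-elim (¬fn<lim (≤ₒ-trans fn<fm (≤ₒ-olim f m)))

-- ordTree α itself can have too large a rank: at α = olim f, some f n may fail to lie below α.
record Realisation (α : Ord) : Set₂ where
  field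
    tree   : Tree
    rank≤  : RankLe α (chainStr tree)
    code   : Ord
    α≤code : α ≤ₒ code
    copy   : ordTree code ↪ᵗ tree

realise : LEM → ∀ α → Realisation α
realise lem ozero = record
  { tree = leaf
  ; rank≤ = base (omega , leaf≅ω)
  ; code = ozero
  ; α≤code = z≤ₒ
  ; copy = mk↪ᵗ (λ x → x) (λ x≺y → x≺y)
  }
realise lem (osuc α) = record
  { tree = node (λ _ → tree)
  ; rank≤ = sum omega (λ _ → chainStr tree) (λ _ → α , ≤ₒ-refl (osuc α) , rank≤) (node≅Σ _)
  ; code = osuc code
  ; α≤code = s≤ₒs α≤code
  ; copy = nodeMap (λ _ → copy)
  }
  where open Realisation (realise lem α)
realise lem (olim f) with lem {P = ∃[ n ] ¬ (f n <ₒ olim f)}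
... | yes (n , ¬fn<lim) = record
  { tree = tree
  ; rank≤ = RankLe-mono (≤ₒ-olim f n) rank≤
  ; code = code
  ; α≤code = ≤ₒ-trans (olim-≤ₒ lem f n ¬fn<lim) α≤code
  ; copy = copy
  }
  where open Realisation (realise lem (f n))
... | no ¬∃ = record
  { tree = node (tree ∘ enum)
  ; rank≤ = sum omega (chainStr ∘ tree ∘ enum)
                (λ k → f (enum k) , ¬∃¬⇒∀ lem ¬∃ (enum k) , rank≤ (enum k)) (node≅Σ _)
  ; code = olim code
  ; α≤code = lim≤ₒ (λ n → ≤ₒlim n (α≤code n))
  ; copy = nodeMap (copy ∘ enum)
  }
  where open module R n = Realisation (realise lem (f n))

AM-copy : ∀ t → t ↪ AM (intervalPoset t)
AM-copy t = mk↪ (λ q → through q , through-maximal q) λ x≺y →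
  Equivalence.from through-Below⇔≼ (inj₁ x≺y) , ≺⇒⋡ x≺y ∘ Equivalence.to through-Below⇔≼

theorem1p5 : (lem : ∀ {ℓ : Level} → ExcludedMiddle ℓ) →
             (α : Ord) →
             Σ[ P ∈ Pos ] (Pos.IsWQO P × Pos.IsPrime P × IsIntervalOrder P
                           × HasHausdorffRank (AM P) α)
theorem1p5 lem α =
  intervalPoset tree , isWQO lem tree , isPrime lem tree , isIntervalOrder tree , rankAM≤α , rankAM≮α
  where
  open Realisation (realise lem α)
  rankAM≤α : RankLe α (AM (intervalPoset tree))
  rankAM≤α = RankLe-≅ tree (AM≅chain lem tree) rank≤
  rankAM≮α : ∀ β → β <ₒ α → ¬ RankLe β (AM (intervalPoset tree))
  rankAM≮α β β<α rankAM≤β =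
    rank-lowerBound lem rankAM≤β code (≤ₒ-trans β<α α≤code) (↪ᵗ-↪-trans copy (AM-copy tree))
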